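{- In the setting described in the context, let $e=(v,w)\in E_\star$ and let $G=\langle V,E\rangle$ and $G'=\langle V,E'\rangle$ be subgraphs of $G_\star$ such that $E'=E\cup\{e\}$ (respectively $E'=E\setminus\{e\}$). Then $\Gamma_{G'}$ is obtained from $\Gamma_G$ by deleting one edge $e_1$ and inserting another edge $e_2$. Moreover, $e_1$ and $e_2$ are first-order definable in terms of $e$, of $\Gamma_G$, and of auxiliary predicates precomputed in advance (independently of the current subgraph $G$).
   Context: Fix a positive integer $\kappa$, an MSO formula $\varphi$, and let $K=4\kappa+3$ and $\Sigma=2^{\{0,\dots,K\}}\times 2^{\{0,\dots,K\}}\times 2^{\{0,\dots,K\}^2}$. Tree automata: a (deterministic, bottom-up) tree automaton is $\mathcal A=\langle Q,\Sigma,\iota,Q_{end},\delta\rangle$ with finite state set $Q$, initial state $\iota$, accepting states $Q_{end}\subseteq Q$ and $\delta:Q^2\times\Sigma\to Q$. The run $\rho$ on a $\Sigma$-labeled binary ordered tree (every internal node has a left child and a right child) is given by $\rho(n)=\delta(\iota,\iota,\lambda(n))$ for a leaf $n$ and $\rho(n)=\delta(\rho(m_1),\rho(m_2),\lambda(n))$ for an internal node with left child $m_1$ and right child $m_2$; $\mathcal A$ accepts if $\rho(\text{root})\in Q_{end}$. Tree decompositions: a tree decomposition of a graph $\langle V,E\rangle$ is $\langle\mathcal T,\mathbf T\rangle$ with $\mathcal T$ a tree and bags $\mathbf T(n)\subseteq V$ such that each edge lies in $\mathbf T(n)^2$ for some $n$ and, for each $v$, the nodes whose bag contains $v$ form a non-empty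 connected subtree; width = max bag size minus 1. Given a binary ordered tree decomposition $\mathcal D=\langle\mathcal T,\mathbf T\rangle$ of width at most $K$, a proper $\mathcal D$-coloring is $\chi:V\to\{0,\dots,K\}$ injective on every bag. The $(\chi,\mathcal D)$-succinct tree decomposition of $\langle V,E\rangle$ is $\mathcal T$ with each node $n$ labeled $\langle\chi(A),\chi(B),\chi(C)\rangle\in\Sigma$, where $A=\mathbf T(n)\cap\mathbf T(m)$ if $n$ has parent $m$ and $A=\emptyset$ at the root, $B=\mathbf T(n)\setminus A$, $C=\{(v,w)\in E : (v,w)\in\mathbf T(n)^2\setminus A^2\}$, and $\chi$ is applied elementwise (componentwise on pairs). Assumption on $\mathcal A$: $\mathcal A$ is a tree automaton over $\Sigma$ such that for every graph $G$ and every succinct tree decomposition $\mathcal T$ of $G$ of width $K$, $G\models\varphi$ iff $\mathcal A$ accepts $\mathcal T$. Setting: $G_\star=\langle V,E_\star\rangle$ is a graph, $\mathcal D_\star=\langle\mathcal T_\star,\mathbf T_\star\rangle$ is a binary ordered tree decomposition of $G_\star$ of width at most $K$ with $N$ nodes, and $\chi$ is a proper $\mathcal D_\star$-coloring. For $E\subseteq E_\star$, $\mathcal D_\star$ is also a tree decomposition of $G=\langle V,E\rangle$; let $\Lambda_G$ be the node labeling making $\mathcal T_\star$ the $(\chi,\mathcal D_\star)$-succinct tree decomposition $\mathcal T_G$ of $G$. Let $n_1,\dots,n_N$ be the nodes of $\mathcal T_\star$ in post order (descendants before ancestors; a left subtree entirely before the right subtree), and $\mathcal S_i=\{n : \mathrm{post}(n)\le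 i,\ \mathrm{post}(m)>i \text{ for all strict ancestors } m\}$ for $0\le i\le N$. For $1\le i\le N$, $\gamma\in\Sigma$ and $\pi:\mathcal S_{i-1}\to Q$, define $\Pi_i(\pi,\gamma):\mathcal S_i\to Q$ by $\Pi_i(\pi,\gamma)(n)=\pi(n)$ for $n\in\mathcal S_{i-1}\cap\mathcal S_i$, and at $n_i$: $\delta(\iota,\iota,\gamma)$ if $n_i$ is a leaf, $\delta(\pi(m_1),\pi(m_2),\gamma)$ if $n_i$ has left child $m_1$ and right child $m_2$. The labeled graph $\Gamma_G$: vertices are all pairs $(i,\pi)$ with $0\le i\le N$ and $\pi:\mathcal S_i\to Q$, the vertices $(i-1)$ and $(i-1,\gamma)$ for $1\le i\le N$ and $\gamma\in\Sigma$, and a vertex $\top$. Labels are $(i,\pi)^+$, $(i,\pi)^-$ and a neutral label $\bullet$. Edges: for $1\le i\le N$, all $\pi:\mathcal S_{i-1}\to Q$ and all $\gamma\in\Sigma$, an edge $(i-1,\pi)\to(i-1)$ labeled $(i-1,\pi)^+$ and an edge $(i-1,\gamma)\to(i,\Pi_i(\pi,\gamma))$ labeled $(i-1,\pi)^-$; for each $1\le i\le N$ one edge $(i-1)\to(i-1,\Lambda_G(n_i))$ labeled $\bullet$; and edges $(N,\pi)\to\top$ labeled $\bullet$ for every $\pi:\mathcal S_N\to Q$ with $\pi(n_N)\in Q_{end}$. -}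

module Defs where

open import Data.Nat using (ℕ; zero; suc; _+_; _*_; _∸_; _≤_; _<_; _≤ᵇ_; _<ᵇ_)
open import Data.Nat.Properties using (≤⇒≤ᵇ; ≤-refl; <⇒≤)
open import Data.Bool using (Bool; true; false; _∧_; _∨_; not; T; if_then_else_)
open import Data.Fin using (Fin; zero; suc; _≟_)
open import Data.Fin.Subset using (Subset; _∈_; _∩_; ∁; ∣_∣)
import Data.Fin.Subset as Sub
open import Data.Vec using (Vec; lookup; tabulate)
open import Data.List using (List; []; _∷_; map)
open import Data.List.Membership.Propositional using () renaming (_∈_ to _∈ₗ_)
open import Data.Maybe using (Maybe; just; nothing)
import Data.Maybe as Maybe
open import Data.Product using (Σ; ∃; _×_; _,_; proj₁; proj₂)
import Data.Product as Prod
open import Data.Sum using (_⊎_; inj₁; inj₂)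
open import Data.Empty using (⊥)
open import Data.Unit using (⊤; tt)
open import Relation.Nullary using (¬_; ⌊_⌋)
open import Relation.Binary.PropositionalEquality using (_≡_; refl; sym; subst)
open import Function.Bundles using (_⇔_)

Kof : ℕ → ℕ
Kof κ = 4 * κ + 3

-- colours {0,…,K} = Fin (suc K); a set of pairs of colours is a Boolean (K+1)×(K+1) matrix
Sig : ℕ → Set
Sig K = Subset (suc K) × Subset (suc K) × Vec (Subset (suc K)) (suc K)

Rel : ℕ → Set
Rel nV = Fin nV → Fin nV → Bool

anyFin : (n : ℕ) → (Fin n → Bool) → Bool
anyFin zero    f = false
anyFin (suc n) f = f zero ∨ anyFin n (λ i → f (suc i))

eqB : {n : ℕ} → Fin n → Fin n → Bool
eqB x y = ⌊ x ≟ y ⌋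

data BTree : Set where
  lf : BTree
  nd : BTree → BTree → BTree

data Pos : BTree → Set where
  here : {t : BTree} → Pos t
  L    : {l r : BTree} → Pos l → Pos (nd l r)
  R    : {l r : BTree} → Pos r → Pos (nd l r)

size : BTree → ℕ
size lf       = 1
size (nd l r) = size l + size r + 1

-- post-order number (1-based): left subtree, then right subtree, then the node
post : {t : BTree} → Pos t → ℕ
post {t} here        = size t
post (L p)           = post p
post {nd l r} (R p)  = size l + post p

children : {t : BTree} → Pos t → Maybe (Pos t × Pos t)
children {lf} here      = nothing
children {nd l r} here  = just (L here , R here)
children (L p)          = Maybe.map (Prod.map L L) (children p)
children (R p)          = Maybe.map (Prod.map R R) (children p)

parent : {t : BTree} → Pos t → Maybe (Pos t)
parent here  = nothing
parent (L p) = Maybe.maybe (λ m → just (L m)) (just here) (parent p)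
parent (R p) = Maybe.maybe (λ m → just (R m)) (just here) (parent p)

strictAnc : {t : BTree} → Pos t → List (Pos t)
strictAnc here  = []
strictAnc (L p) = here ∷ map L (strictAnc p)
strictAnc (R p) = here ∷ map R (strictAnc p)

AncEq : {t : BTree} → Pos t → Pos t → Set
AncEq p n = p ∈ₗ (n ∷ strictAnc n)

-- p lies on the (unique) path between n and m in the tree
OnPath : {t : BTree} → Pos t → Pos t → Pos t → Set
OnPath p n m = (AncEq p n ⊎ AncEq p m) × (∀ q → AncEq q n → AncEq q m → AncEq q p)

record IsTreeDecomposition (nV : ℕ) (E : Rel nV) (t : BTree) (bags : Pos t → Subset nV) : Set where
  field
    covers    : ∀ x y → T (E x y) → ∃ λ n → x ∈ bags n × y ∈ bags n
    nonempty  : ∀ x → ∃ λ n → x ∈ bags n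
    connected : ∀ x n m p → x ∈ bags n → x ∈ bags m → OnPath p n m → x ∈ bags p

WidthAtMost : {nV : ℕ} {t : BTree} → ℕ → (Pos t → Subset nV) → Set
WidthAtMost K bags = ∀ n → ∣ bags n ∣ ≤ suc K

ProperColoring : {nV K : ℕ} {t : BTree} → (Pos t → Subset nV) → (Fin nV → Fin (suc K)) → Set
ProperColoring bags χ = ∀ n x y → x ∈ bags n → y ∈ bags n → χ x ≡ χ y → x ≡ y

module _ {nV K : ℕ} {t : BTree} (E : Rel nV) (bags : Pos t → Subset nV)
         (χ : Fin nV → Fin (suc K)) where

  Aset : Pos t → Subset nV
  Aset n = Maybe.maybe (λ m → bags n ∩ bags m) Sub.⊥ (parent n)

  Bset : Pos t → Subset nV
  Bset n = bags n ∩ ∁ (Aset n)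

  Cpair : Pos t → Fin nV → Fin nV → Bool
  Cpair n x y = E x y ∧ lookup (bags n) x ∧ lookup (bags n) y
                ∧ not (lookup (Aset n) x ∧ lookup (Aset n) y)

  imgχ : Subset nV → Subset (suc K)
  imgχ S = tabulate (λ a → anyFin nV (λ x → lookup S x ∧ eqB (χ x) a))

  imgχ² : (Fin nV → Fin nV → Bool) → Vec (Subset (suc K)) (suc K)
  imgχ² C = tabulate (λ a → tabulate (λ b →
              anyFin nV (λ x → anyFin nV (λ y → C x y ∧ eqB (χ x) a ∧ eqB (χ y) b))))

  succinctLabel : Pos t → Sig K
  succinctLabel n = imgχ (Aset n) , imgχ (Bset n) , imgχ² (Cpair n)

record Automaton (K q : ℕ) : Set where
  field
    ι    : Fin q
    Qend : Subset q
    δ    : Fin q → Fin q → Sig K → Fin q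

runRoot : {K q : ℕ} → Automaton K q → (t : BTree) → (Pos t → Sig K) → Fin q
runRoot 𝒜 lf       λ' = Automaton.δ 𝒜 (Automaton.ι 𝒜) (Automaton.ι 𝒜) (λ' here)
runRoot 𝒜 (nd l r) λ' = Automaton.δ 𝒜 (runRoot 𝒜 l (λ p → λ' (L p)))
                                       (runRoot 𝒜 r (λ p → λ' (R p))) (λ' here)

Accepts : {K q : ℕ} → Automaton K q → (t : BTree) → (Pos t → Sig K) → Set
Accepts 𝒜 t λ' = runRoot 𝒜 t λ' ∈ Automaton.Qend 𝒜

data MSO (n m : ℕ) : Set where
  edgeᴹ : Fin n → Fin n → MSO n m
  eqᴹ   : Fin n → Fin n → MSO n m
  memᴹ  : Fin n → Fin m → MSO n m
  notᴹ  : MSO n m → MSO n m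
  andᴹ  : MSO n m → MSO n m → MSO n m
  orᴹ   : MSO n m → MSO n m → MSO n m
  exᴹ   : MSO (suc n) m → MSO n m
  allᴹ  : MSO (suc n) m → MSO n m
  exSᴹ  : MSO n (suc m) → MSO n m
  allSᴹ : MSO n (suc m) → MSO n m

extend : {A : Set} {n : ℕ} → (Fin n → A) → A → Fin (suc n) → A
extend ρ a zero    = a
extend ρ a (suc i) = ρ i

SatMSO : {nV n m : ℕ} → Rel nV → MSO n m → (Fin n → Fin nV) → (Fin m → Subset nV) → Set
SatMSO E (edgeᴹ i j) ρ σ = T (E (ρ i) (ρ j))
SatMSO E (eqᴹ i j)   ρ σ = ρ i ≡ ρ j
SatMSO E (memᴹ i X)  ρ σ = ρ i ∈ σ X
SatMSO E (notᴹ φ)    ρ σ = ¬ SatMSO E φ ρ σ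
SatMSO E (andᴹ φ ψ)  ρ σ = SatMSO E φ ρ σ × SatMSO E ψ ρ σ
SatMSO E (orᴹ φ ψ)   ρ σ = SatMSO E φ ρ σ ⊎ SatMSO E ψ ρ σ
SatMSO E (exᴹ φ)     ρ σ = ∃ λ x → SatMSO E φ (extend ρ x) σ
SatMSO E (allᴹ φ)    ρ σ = ∀ x → SatMSO E φ (extend ρ x) σ
SatMSO E (exSᴹ φ)    ρ σ = ∃ λ X → SatMSO E φ ρ (extend σ X)
SatMSO E (allSᴹ φ)   ρ σ = ∀ X → SatMSO E φ ρ (extend σ X)

noVars : {A : Set} → Fin 0 → A
noVars ()

Models : {nV : ℕ} → Rel nV → MSO 0 0 → Set
Models E φ = SatMSO E φ noVars noVars

AutomatonFor : {K q : ℕ} → MSO 0 0 → Automaton K q → Set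
AutomatonFor {K} φ 𝒜 =
  ∀ (nV : ℕ) (E : Rel nV) (t : BTree) (bags : Pos t → Subset nV) (χ : Fin nV → Fin (suc K)) →
  IsTreeDecomposition nV E t bags → WidthAtMost K bags → ProperColoring bags χ →
  (Models E φ ⇔ Accepts 𝒜 t (succinctLabel E bags χ))

allB : {A : Set} → (A → Bool) → List A → Bool
allB f []       = true
allB f (x ∷ xs) = f x ∧ allB f xs

inS : {t : BTree} → ℕ → Pos t → Bool
inS i n = allB (λ m → i <ᵇ post m) (strictAnc n) ∧ (post n ≤ᵇ i)

Front : BTree → ℕ → Set
Front t i = Σ (Pos t) (λ n → T (inS i n))

root∈𝒮N : {t : BTree} → T (inS {t} (size t) here)
root∈𝒮N {t} = ≤⇒≤ᵇ (≤-refl {size t})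

module Gamma {K q : ℕ} (𝒜 : Automaton K q) (t : BTree) where
  open Automaton 𝒜

  N : ℕ
  N = size t

  -- value of π at m, if m ∈ 𝒮ᵢ (the fallback ι is never used)
  at : (i : ℕ) → (Front t i → Fin q) → Pos t → Fin q
  at i π m with inS i m in eq
  ... | true  = π (m , subst T (sym eq) tt)
  ... | false = ι

  -- Πᵢ(π,γ) for i = suc j : 𝒮_{j} → Q  ↦  𝒮_{suc j} → Q
  Π : (j : ℕ) → (Front t j → Fin q) → Sig K → Front t (suc j) → Fin q
  Π j π γ (n , _) with inS j n in eq
  ... | true  = π (n , subst T (sym eq) tt)
  ... | false with children n
  ...   | nothing          = δ ι ι γ
  ...   | just (m₁ , m₂)   = δ (at j π m₁) (at j π m₂) γ

  -- vertices: (i,π) for 0 ≤ i ≤ N; (i-1) and (i-1,γ) for 1 ≤ i ≤ N; ⊤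
  data Vtx : Set where
    st  : (i : ℕ) → .(i ≤ N) → (Front t i → Fin q) → Vtx
    pre : (j : ℕ) → .(j < N) → Vtx
    lab : (j : ℕ) → .(j < N) → Sig K → Vtx
    top : Vtx

  data Lbl : Set where
    plus  : (i : ℕ) → .(i ≤ N) → (Front t i → Fin q) → Lbl
    minus : (i : ℕ) → .(i ≤ N) → (Front t i → Fin q) → Lbl
    bullet : Lbl

  data Edge (lab' : Pos t → Sig K) : Vtx → Lbl → Vtx → Set where
    e⁺ : (j : ℕ) (j<N : j < N) (π : Front t j → Fin q) →
         Edge lab' (st j (<⇒≤ j<N) π) (plus j (<⇒≤ j<N) π) (pre j j<N)
    e⁻ : (j : ℕ) (j<N : j < N) (π : Front t j → Fin q) (γ : Sig K) →
         Edge lab' (lab j j<N γ) (minus j (<⇒≤ j<N) π) (st (suc j) j<N (Π j π γ))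
    e• : (j : ℕ) (j<N : j < N) (n : Pos t) → post n ≡ suc j →
         Edge lab' (pre j j<N) bullet (lab j j<N (lab' n))
    e⊤ : (π : Front t N → Fin q) → π (here , root∈𝒮N {t}) ∈ Qend →
         Edge lab' (st N ≤-refl π) bullet top

record AuxRels (D : Set) : Set₁ where
  field
    k   : ℕ
    ar  : Fin k → ℕ
    rel : (r : Fin k) → (Fin (ar r) → D) → Set

data FO {D : Set} (aux : AuxRels D) (n : ℕ) : Set where
  edgeᶠ : Fin n → Fin n → Fin n → FO aux n
  relᶠ  : (r : Fin (AuxRels.k aux)) → (Fin (AuxRels.ar aux r) → Fin n) → FO aux n
  eqᶠ   : Fin n → Fin n → FO aux n
  notᶠ  : FO aux n → FO aux n
  andᶠ  : FO aux n → FO aux n → FO aux n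
  orᶠ   : FO aux n → FO aux n → FO aux n
  exᶠ   : FO aux (suc n) → FO aux n
  allᶠ  : FO aux (suc n) → FO aux n

SatFO : {D : Set} {aux : AuxRels D} {n : ℕ} → (D → D → D → Set) → FO aux n → (Fin n → D) → Set
SatFO Γ (edgeᶠ i j l) ρ = Γ (ρ i) (ρ j) (ρ l)
SatFO {aux = aux} Γ (relᶠ r xs) ρ = AuxRels.rel aux r (λ a → ρ (xs a))
SatFO Γ (eqᶠ i j)   ρ = ρ i ≡ ρ j
SatFO Γ (notᶠ φ)    ρ = ¬ SatFO Γ φ ρ
SatFO Γ (andᶠ φ ψ)  ρ = SatFO Γ φ ρ × SatFO Γ ψ ρ
SatFO Γ (orᶠ φ ψ)   ρ = SatFO Γ φ ρ ⊎ SatFO Γ ψ ρ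
SatFO Γ (exᶠ φ)     ρ = ∃ λ x → SatFO Γ φ (extend ρ x)
SatFO Γ (allᶠ φ)    ρ = ∀ x → SatFO Γ φ (extend ρ x)

env5 : {D : Set} → D → D → D → D → D → Fin 5 → D
env5 a b c d e zero                         = a
env5 a b c d e (suc zero)                   = b
env5 a b c d e (suc (suc zero))             = c
env5 a b c d e (suc (suc (suc zero)))       = d
env5 a b c d e (suc (suc (suc (suc zero)))) = e

data Update : Set where
  insert delete : Update

updateRel : {nV : ℕ} → Update → Rel nV → Fin nV → Fin nV → Rel nV
updateRel insert E v w x y = E x y ∨ (eqB x v ∧ eqB y w)
updateRel delete E v w x y = E x y ∧ not (eqB x v ∧ eqB y w)

SubRel : {nV : ℕ} → Rel nV → Rel nV → Set
SubRel E E⋆ = ∀ x y → T (E x y) → T (E⋆ x y)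

module _ {K q : ℕ} (𝒜 : Automaton K q) (t : BTree) where
  open Gamma 𝒜 t

  Dom : ℕ → Set
  Dom nV = Fin nV ⊎ Vtx ⊎ Lbl

  ΓRel : {nV : ℕ} → (Pos t → Sig K) → Dom nV → Dom nV → Dom nV → Set
  ΓRel lab' (inj₂ (inj₁ x)) (inj₂ (inj₂ l)) (inj₂ (inj₁ y)) = Edge lab' x l y
  ΓRel lab' _ _ _ = ⊥

  Triple : Set
  Triple = Vtx × Lbl × Vtx

  EdgeT : (Pos t → Sig K) → Triple → Set
  EdgeT lab' (x , l , y) = Edge lab' x l y

  DeleteInsert : (Pos t → Sig K) → (Pos t → Sig K) → Triple → Triple → Set
  DeleteInsert λG λG' e₁ e₂ = EdgeT λG e₁ ×
    (∀ x l y → Edge λG' x l y ⇔ ((Edge λG x l y × ¬ ((x , l , y) ≡ e₁)) ⊎ (x , l , y) ≡ e₂))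

  DefinesEdge : {nV : ℕ} {aux : AuxRels (Dom nV)} → FO aux 5 → (Pos t → Sig K) →
                Fin nV → Fin nV → Triple → Set
  DefinesEdge {nV} ψ λG v w (x , l , y) =
    ∀ (a b c : Dom nV) →
      SatFO (ΓRel λG) ψ (env5 (inj₁ v) (inj₁ w) a b c)
        ⇔ (a ≡ inj₂ (inj₁ x) × b ≡ inj₂ (inj₂ l) × c ≡ inj₂ (inj₁ y))

-- An edge (v, w) of G⋆ is recorded in the third label component of exactly one node of the
-- succinct decomposition, the node n whose bag contains v and w while its parent bag does not
-- contain both.  It is unique: of two such nodes, the parent of the one that comes first in post
-- order lies on the path between them, so by connectivity its bag contains v and w.  Inserting
-- or deleting (v, w) therefore changes only the label of n, and there only the matrix entry
-- (χ v, χ w), which by properness of χ records no other pair.  The labelling enters Γ_G only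
-- through the •-edges (j) → (j, Λ_G(n_{j+1})), so exactly the •-edge of n is replaced.  Its slot
-- j and the map from the old to the new label depend on (v, w) but not on G; as auxiliary
-- relations they make both edges first-order definable.

module Submission where

open import Defs
open import Data.Bool using (Bool; true; false; _∧_; _∨_; not; T; if_then_else_)
open import Data.Bool.Properties using (T-∧; T-∨; T-≡; T-not-≡; ∧-zeroʳ; ∧-identityʳ; ∨-zeroʳ; ∨-identityʳ)
open import Data.Empty using (⊥; ⊥-elim)
open import Data.Fin using (Fin; zero; suc; #_) renaming (_≟_ to _≟ᶠ_)
open import Data.Fin.Subset using (Subset; _∈_)
open import Data.Fin.Subset.Properties using (x∈p∩q⁺)
open import Data.List using (_∷_; map)
open import Data.List.Membership.Propositional using () renaming (_∈_ to _∈ₗ_)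
open import Data.List.Membership.Propositional.Properties using (∈-map⁺; ∈-map⁻)
open import Data.List.Relation.Unary.Any using (here; there)
open import Data.Maybe using (just)
open import Data.Nat using (ℕ; zero; suc; pred; _+_; _≤_; _<_; z≤n; s≤s)
open import Data.Nat.Properties
open import Data.Product using (Σ; ∃; _×_; _,_; proj₁; proj₂)
open import Data.Sum using (_⊎_; inj₁; inj₂)
open import Data.Unit using (tt)
open import Data.Vec using (Vec; []; _∷_; lookup; tabulate)
open import Data.Vec.Properties using (lookup∘tabulate; tabulate-cong; []=⇒lookup; lookup⇒[]=)
open import Function using (_∘_; id; case_of_)
open import Function.Bundles using (_⇔_; mk⇔; Equivalence)
open import Relation.Binary using (tri<; tri≈; tri>)
open import Relation.Binary.PropositionalEquality
open import Relation.Nullary using (¬_; Dec; yes; no)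
open import Relation.Nullary.Decidable using (_×-dec_; _⊎-dec_; map′; T?)

private variable
  s t : BTree

here-anc : (p : Pos t) → AncEq here p
here-anc here  = here refl
here-anc (L p) = there (here refl)
here-anc (R p) = there (here refl)

-- AncEq q (L p) and AncEq q (R p) unfold to this shape, with c = L resp. c = R.
anc-child⁻ : {c : Pos s → Pos t} {q : Pos t} {p : Pos s} →
             q ∈ₗ c p ∷ here ∷ map c (strictAnc p) → q ≡ here ⊎ ∃ λ q′ → q ≡ c q′ × AncEq q′ p
anc-child⁻ (here q≡cp)          = inj₂ (_ , q≡cp , here refl)
anc-child⁻ (there (here q≡here)) = inj₁ q≡here
anc-child⁻ {c = c} (there (there q∈)) with ∈-map⁻ c q∈
... | q′ , q′∈ , refl = inj₂ (q′ , refl , there q′∈)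

anc-child⁺ : {c : Pos s → Pos t} {q p : Pos s} →
             AncEq q p → c q ∈ₗ c p ∷ here ∷ map c (strictAnc p)
anc-child⁺ {c = c} (here refl) = here refl
anc-child⁺ {c = c} (there q∈)  = there (there (∈-map⁺ c q∈))

IsParentOf : Pos t → Pos t → Set
IsParentOf p m = parent m ≡ just p × p ∈ₗ strictAnc m × (∀ q → q ∈ₗ strictAnc m → AncEq q p)

parent-spec : (m : Pos t) → m ≡ here ⊎ ∃ λ p → IsParentOf p m
parent-spec here = inj₁ refl
parent-spec (L m) with parent-spec m
... | inj₁ refl = inj₂ (here , refl , here refl , λ { q (here q≡here) → here q≡here })
... | inj₂ (p , m→p , p∈ , below-p) rewrite m→p =
  inj₂ (L p , refl , there (∈-map⁺ L p∈) , below-Lp)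
  where
  below-Lp : ∀ q → q ∈ₗ strictAnc (L m) → AncEq q (L p)
  below-Lp q (here refl)  = here-anc (L p)
  below-Lp q (there q∈) with ∈-map⁻ L q∈
  ... | q′ , q′∈ , refl = anc-child⁺ {c = L} (below-p q′ q′∈)
parent-spec (R m) with parent-spec m
... | inj₁ refl = inj₂ (here , refl , here refl , λ { q (here q≡here) → here q≡here })
... | inj₂ (p , m→p , p∈ , below-p) rewrite m→p =
  inj₂ (R p , refl , there (∈-map⁺ R p∈) , below-Rp)
  where
  below-Rp : ∀ q → q ∈ₗ strictAnc (R m) → AncEq q (R p)
  below-Rp q (here refl)  = here-anc (R p)
  below-Rp q (there q∈) with ∈-map⁻ R q∈
  ... | q′ , q′∈ , refl = anc-child⁺ {c = R} (below-p q′ q′∈)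

1≤post : (p : Pos t) → 1 ≤ post p
1≤post {lf}     here  = ≤-refl
1≤post {nd l r} here  = m≤n+m 1 (size l + size r)
1≤post          (L p) = 1≤post p
1≤post {nd l r} (R p) = ≤-trans (1≤post p) (m≤n+m (post p) (size l))

size<size-nd : (l r : BTree) → size l + size r < size (nd l r)
size<size-nd l r = m<m+n (size l + size r) (s≤s z≤n)

post≤size : (p : Pos t) → post p ≤ size t
post≤size here           = ≤-refl
post≤size {nd l r} (L p) = ≤-trans (post≤size p) (<⇒≤ (≤-<-trans (m≤m+n (size l) (size r)) (size<size-nd l r)))
post≤size {nd l r} (R p) = <⇒≤ (≤-<-trans (+-monoʳ-≤ (size l) (post≤size p)) (size<size-nd l r))

postL<postR : {l r : BTree} (p : Pos l) (q : Pos r) → post (L {r = r} p) < post (R {l = l} q)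
postL<postR {l} p q = ≤-<-trans (post≤size p) (m<m+n (size l) (1≤post q))

post<size : {t : BTree} (p : Pos t) → p ≢ here → post p < size t
post<size here  p≢here = ⊥-elim (p≢here refl)
post<size {nd l r} (L p) _ = ≤-<-trans (post≤size p) (≤-<-trans (m≤m+n (size l) (size r)) (size<size-nd l r))
post<size {nd l r} (R p) _ = ≤-<-trans (+-monoʳ-≤ (size l) (post≤size p)) (size<size-nd l r)

post≡size⇒here : (p : Pos t) → post p ≡ size t → p ≡ here
post≡size⇒here here _ = refl
post≡size⇒here {nd l r} (L p) e = ⊥-elim (<⇒≢ (post<size {nd l r} (L p) λ ()) e)
post≡size⇒here {nd l r} (R p) e = ⊥-elim (<⇒≢ (post<size {nd l r} (R p) λ ()) e)

post-injective : {p q : Pos t} → post p ≡ post q → p ≡ q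
post-injective {p = here} {q}    e = sym (post≡size⇒here q (sym e))
post-injective {p = p}    {here} e = post≡size⇒here p e
post-injective {p = L p}  {L q}  e = cong L (post-injective e)
post-injective {p = R p}  {R q}  e = cong R (post-injective (+-cancelˡ-≡ _ _ _ e))
post-injective {p = L p}  {R q}  e = ⊥-elim (<⇒≢ (postL<postR p q) e)
post-injective {p = R p}  {L q}  e = ⊥-elim (<⇒≢ (postL<postR q p) (sym e))

post-ancestor : {q n : Pos t} → AncEq q n → post n ≤ post q
post-ancestor {n = here} (here refl) = ≤-refl
post-ancestor {nd l r} {n = L n} a with anc-child⁻ {c = L} a
... | inj₁ refl = post≤size {nd l r} (L n)
... | inj₂ (q′ , refl , a′) = post-ancestor a′
post-ancestor {nd l r} {n = R n} a with anc-child⁻ {c = R} a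
... | inj₁ refl = post≤size {nd l r} (R n)
... | inj₂ (q′ , refl , a′) = +-monoʳ-≤ _ (post-ancestor a′)

parent-on-path : {n m : Pos t} → post m < post n → ∃ λ p → parent m ≡ just p × OnPath p n m
parent-on-path {n = n} {m} m<n with parent-spec m
... | inj₁ refl = ⊥-elim (<⇒≱ m<n (post≤size n))
... | inj₂ (p , m→p , p∈ , below-p) = p , m→p , inj₂ (there p∈) , λ q qn qm → below-p q (strict q qn qm)
  where
  strict : ∀ q → AncEq q n → AncEq q m → q ∈ₗ strictAnc m
  strict q qn (here refl) = ⊥-elim (<⇒≱ m<n (post-ancestor qn))
  strict q qn (there q∈)  = q∈

anyPos? : (f : Pos t → Bool) → Dec (∃ λ p → T (f p))
anyPos? {lf}     f = map′ (here ,_) (λ { (here , h) → h }) (T? (f here))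
anyPos? {nd l r} f = map′ join split (T? (f here) ⊎-dec anyPos? (f ∘ L) ⊎-dec anyPos? (f ∘ R))
  where
  join : T (f here) ⊎ (∃ λ p → T (f (L p))) ⊎ (∃ λ p → T (f (R p))) → ∃ λ p → T (f p)
  join (inj₁ h)              = here , h
  join (inj₂ (inj₁ (p , h))) = L p , h
  join (inj₂ (inj₂ (p , h))) = R p , h
  split : (∃ λ p → T (f p)) → T (f here) ⊎ (∃ λ p → T (f (L p))) ⊎ (∃ λ p → T (f (R p)))
  split (here , h) = inj₁ h
  split (L p , h)  = inj₂ (inj₁ (p , h))
  split (R p , h)  = inj₂ (inj₂ (p , h))

T⇔T⇒≡ : {a b : Bool} → T a ⇔ T b → a ≡ b
T⇔T⇒≡ {false} {false} _   = refl
T⇔T⇒≡ {true}  {true}  _   = refl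
T⇔T⇒≡ {true}  {false} a⇔b = ⊥-elim (Equivalence.to a⇔b tt)
T⇔T⇒≡ {false} {true}  a⇔b = ⊥-elim (Equivalence.from a⇔b tt)

T-∧₃ : ∀ {a b c} → T (a ∧ b ∧ c) ⇔ (T a × T b × T c)
T-∧₃ {true}  {true}  = mk⇔ (λ Tc → tt , tt , Tc) (proj₂ ∘ proj₂)
T-∧₃ {true}  {false} = mk⇔ (λ ()) (λ { (_ , () , _) })
T-∧₃ {false}         = mk⇔ (λ ()) (λ { (() , _) })

¬T⇒≡false : {b : Bool} → ¬ T b → b ≡ false
¬T⇒≡false {false} _ = refl
¬T⇒≡false {true}  ¬T = ⊥-elim (¬T tt)

T-eqB : {n : ℕ} {x y : Fin n} → T (eqB x y) ⇔ x ≡ y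
T-eqB {x = x} {y} with x ≟ᶠ y
... | yes x≡y = mk⇔ (λ _ → x≡y) (λ _ → tt)
... | no  x≢y = mk⇔ (λ ()) x≢y

eqB-pair : {n m : ℕ} {x v : Fin n} {y w : Fin m} → ¬ (x ≡ v × y ≡ w) → eqB x v ∧ eqB y w ≡ false
eqB-pair {x = x} {v} {y} {w} ne with x ≟ᶠ v | y ≟ᶠ w
... | yes refl | yes refl = ⊥-elim (ne (refl , refl))
... | yes _    | no _     = refl
... | no _     | _        = refl

anyFin⁺ : ∀ n {f : Fin n → Bool} i → T (f i) → T (anyFin n f)
anyFin⁺ (suc n) zero    h = Equivalence.from T-∨ (inj₁ h)
anyFin⁺ (suc n) (suc i) h = Equivalence.from T-∨ (inj₂ (anyFin⁺ n i h))

anyFin⁻ : ∀ n {f : Fin n → Bool} → T (anyFin n f) → ∃ λ i → T (f i)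
anyFin⁻ (suc n) {f} h with Equivalence.to (T-∨ {f zero}) h
... | inj₁ h₀ = zero , h₀
... | inj₂ hs with anyFin⁻ n hs
...   | i , hi = suc i , hi

anyFin-cong : ∀ n {f g : Fin n → Bool} → (∀ i → f i ≡ g i) → anyFin n f ≡ anyFin n g
anyFin-cong zero    f≗g = refl
anyFin-cong (suc n) f≗g = cong₂ _∨_ (f≗g zero) (anyFin-cong n (λ i → f≗g (suc i)))

setEntry : {k : ℕ} → Fin k → Fin k → Bool → Vec (Subset k) k → Vec (Subset k) k
setEntry a₀ b₀ x M = tabulate λ a → tabulate λ b →
  if eqB a a₀ ∧ eqB b b₀ then x else lookup (lookup M a) b

setLabelEntry : {K : ℕ} → Fin (suc K) → Fin (suc K) → Bool → Sig K → Sig K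
setLabelEntry a b x (A , B , C) = A , B , setEntry a b x C

bit : Update → Bool
bit insert = true
bit delete = false

eqB-refl : {n : ℕ} (x : Fin n) → eqB x x ≡ true
eqB-refl x with x ≟ᶠ x
... | yes _   = refl
... | no  x≢x = ⊥-elim (x≢x refl)

updateRel-at : ∀ {nV} u (E : Rel nV) v w → updateRel u E v w v w ≡ bit u
updateRel-at insert E v w rewrite eqB-refl v | eqB-refl w = ∨-zeroʳ (E v w)
updateRel-at delete E v w rewrite eqB-refl v | eqB-refl w = ∧-zeroʳ (E v w)

updateRel-other : ∀ {nV} u (E : Rel nV) {v w x y} → ¬ (x ≡ v × y ≡ w) → updateRel u E v w x y ≡ E x y
updateRel-other insert E {x = x} {y} ne rewrite eqB-pair ne = ∨-identityʳ (E x y)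
updateRel-other delete E {x = x} {y} ne rewrite eqB-pair ne = ∧-identityʳ (E x y)

module EdgeUpdate {K nV : ℕ} (E⋆ : Rel nV) {t : BTree} (bags : Pos t → Subset nV)
                   (χ : Fin nV → Fin (suc K)) where

  img² : (Fin nV → Fin nV → Bool) → Vec (Subset (suc K)) (suc K)
  img² = imgχ² E⋆ bags χ

  hits : (Fin nV → Fin nV → Bool) → Fin (suc K) → Fin (suc K) → Bool
  hits C a b = anyFin nV λ y → anyFin nV λ z → C y z ∧ eqB (χ y) a ∧ eqB (χ z) b

  lookup-img² : ∀ C a b → lookup (lookup (img² C) a) b ≡ hits C a b
  lookup-img² C a b rewrite lookup∘tabulate (λ a → tabulate (hits C a)) a = lookup∘tabulate (hits C a) b

  img²-cong : {C C′ : Fin nV → Fin nV → Bool} → (∀ y z → C′ y z ≡ C y z) → img² C′ ≡ img² C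
  img²-cong C′≗C = tabulate-cong λ a → tabulate-cong λ b →
    anyFin-cong nV λ y → anyFin-cong nV λ z → cong (_∧ eqB (χ y) a ∧ eqB (χ z) b) (C′≗C y z)

  img²-update : (C C′ : Fin nV → Fin nV → Bool) {v w : Fin nV} {x : Bool} →
                (∀ y z → ¬ (y ≡ v × z ≡ w) → C′ y z ≡ C y z) → C′ v w ≡ x →
                (∀ y z → T (C′ y z) → χ y ≡ χ v → χ z ≡ χ w → y ≡ v × z ≡ w) →
                img² C′ ≡ setEntry (χ v) (χ w) x (img² C)
  img²-update C C′ {v} {w} {x} off at sep = tabulate-cong λ a → tabulate-cong λ b → entry a b
    where
    hit : T (hits C′ (χ v) (χ w)) ⇔ T x
    hit = mk⇔ to from
      where
      to : T (hits C′ (χ v) (χ w)) → T x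
      to h = let y , hy             = anyFin⁻ nV h
                 z , hyz            = anyFin⁻ nV hy
                 C′yz , χy≡ , χz≡   = Equivalence.to T-∧₃ hyz
                 y≡v , z≡w          = sep y z C′yz (Equivalence.to T-eqB χy≡) (Equivalence.to T-eqB χz≡)
             in  subst T at (subst₂ (λ y z → T (C′ y z)) y≡v z≡w C′yz)
      from : T x → T (hits C′ (χ v) (χ w))
      from Tx = anyFin⁺ nV v (anyFin⁺ nV w (Equivalence.from (T-∧₃ {C′ v w} {eqB (χ v) (χ v)})
                  (subst T (sym at) Tx , Equivalence.from T-eqB refl , Equivalence.from T-eqB refl)))
    miss : ∀ {a b} → ¬ (a ≡ χ v × b ≡ χ w) → ∀ y z →
           C′ y z ∧ eqB (χ y) a ∧ eqB (χ z) b ≡ C y z ∧ eqB (χ y) a ∧ eqB (χ z) b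
    miss ne y z with (y ≟ᶠ v) ×-dec (z ≟ᶠ w)
    ... | yes (refl , refl) rewrite eqB-pair (λ (χv≡a , χw≡b) → ne (sym χv≡a , sym χw≡b)) =
          trans (∧-zeroʳ (C′ v w)) (sym (∧-zeroʳ (C v w)))
    ... | no  ne′ = cong (_∧ _) (off y z ne′)
    entry : ∀ a b → hits C′ a b ≡ (if eqB a (χ v) ∧ eqB b (χ w) then x else lookup (lookup (img² C) a) b)
    entry a b with a ≟ᶠ χ v | b ≟ᶠ χ w
    ... | yes refl | yes refl = T⇔T⇒≡ hit
    ... | yes _    | no b≢χw  rewrite lookup-img² C a b = anyFin-cong nV λ y → anyFin-cong nV (miss (b≢χw ∘ proj₂) y)
    ... | no a≢χv  | _        rewrite lookup-img² C a b = anyFin-cong nV λ y → anyFin-cong nV (miss (a≢χv ∘ proj₁) y)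

  adhesion : Pos t → Subset nV
  adhesion = Aset E⋆ bags χ

  introduces : Fin nV → Fin nV → Pos t → Bool
  introduces v w n = lookup (bags n) v ∧ lookup (bags n) w ∧ not (lookup (adhesion n) v ∧ lookup (adhesion n) w)

  introduces⇒ : ∀ {v w n} → T (introduces v w n) → v ∈ bags n × w ∈ bags n × ¬ (v ∈ adhesion n × w ∈ adhesion n)
  introduces⇒ {v} {w} {n} h with Equivalence.to T-∧₃ h
  ... | v∈n , w∈n , fresh =
    lookup⇒[]= v (bags n) (Equivalence.to T-≡ v∈n) , lookup⇒[]= w (bags n) (Equivalence.to T-≡ w∈n) ,
    λ (v∈A , w∈A) → case trans (sym (cong₂ _∧_ ([]=⇒lookup v∈A) ([]=⇒lookup w∈A))) (Equivalence.to T-not-≡ fresh) of λ ()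

  adhesion-parent : ∀ {m p x} → parent m ≡ just p → x ∈ bags m → x ∈ bags p → x ∈ adhesion m
  adhesion-parent m→p x∈m x∈p rewrite m→p = x∈p∩q⁺ (x∈m , x∈p)

  -- When no node introduces (v, w) no label changes, and any node will do.
  introNode : Fin nV → Fin nV → Pos t
  introNode v w with anyPos? (introduces v w)
  ... | yes (p , _) = p
  ... | no _        = here

  relabel : Update → Fin nV → Fin nV → Sig K → Sig K
  relabel u v w with anyPos? (introduces v w)
  ... | yes _ = setLabelEntry (χ v) (χ w) (bit u)
  ... | no _  = id

  module _ (td : IsTreeDecomposition nV E⋆ t bags) where
    open IsTreeDecomposition td

    introduces-later : ∀ {v w n m} → T (introduces v w n) → T (introduces v w m) → ¬ post m < post n
    introduces-later {v} {w} {n} {m} vwn vwm m<n with parent-on-path m<n | introduces⇒ vwn | introduces⇒ vwm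
    ... | p , m→p , p-on-path | v∈n , w∈n , _ | v∈m , w∈m , fresh =
      fresh (adhesion-parent m→p v∈m (connected v n m p v∈n v∈m p-on-path) ,
             adhesion-parent m→p w∈m (connected w n m p w∈n w∈m p-on-path))

    introduces-unique : ∀ {v w n m} → T (introduces v w n) → T (introduces v w m) → n ≡ m
    introduces-unique {n = n} {m} vwn vwm with <-cmp (post n) (post m)
    ... | tri< n<m _ _ = ⊥-elim (introduces-later vwm vwn n<m)
    ... | tri≈ _ n≡m _ = post-injective n≡m
    ... | tri> _ _ m<n = ⊥-elim (introduces-later vwn vwm m<n)

    introduces⇒introNode : ∀ {v w m} → T (introduces v w m) → m ≡ introNode v w
    introduces⇒introNode {v} {w} vwm with anyPos? (introduces v w)
    ... | yes (p , vwp) = introduces-unique vwm vwp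
    ... | no none       = ⊥-elim (none (_ , vwm))

  -- Only the third component of a succinct label depends on the edge relation.
  label-from-matrix : ∀ (E E′ : Rel nV) m {C} → img² (Cpair E′ bags χ m) ≡ C →
                      succinctLabel E′ bags χ m ≡ (proj₁ (succinctLabel E bags χ m) , proj₁ (proj₂ (succinctLabel E bags χ m)) , C)
  label-from-matrix E E′ m refl = refl

  module _ (proper : ProperColoring bags χ) (u : Update) (E : Rel nV) (v w : Fin nV) where
    private
      E′ : Rel nV
      E′ = updateRel u E v w

    Cpair-off : ∀ m y z → ¬ (y ≡ v × z ≡ w) → Cpair E′ bags χ m y z ≡ Cpair E bags χ m y z
    Cpair-off m y z yz≢vw = cong (_∧ introduces y z m) (updateRel-other u E yz≢vw)

    label-unchanged : ∀ m → ¬ T (introduces v w m) → succinctLabel E′ bags χ m ≡ succinctLabel E bags χ m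
    label-unchanged m vw∉m = label-from-matrix E E′ m (img²-cong Cpair-unchanged)
      where
      Cpair-unchanged : ∀ y z → Cpair E′ bags χ m y z ≡ Cpair E bags χ m y z
      Cpair-unchanged y z with (y ≟ᶠ v) ×-dec (z ≟ᶠ w)
      ... | yes (refl , refl) rewrite ¬T⇒≡false vw∉m = trans (∧-zeroʳ (E′ v w)) (sym (∧-zeroʳ (E v w)))
      ... | no  yz≢vw = Cpair-off m y z yz≢vw

    label-introducing : ∀ m → T (introduces v w m) →
                        succinctLabel E′ bags χ m ≡ setLabelEntry (χ v) (χ w) (bit u) (succinctLabel E bags χ m)
    label-introducing m vw∈m = label-from-matrix E E′ m (img²-update (Cpair E bags χ m) (Cpair E′ bags χ m) (Cpair-off m) at sep)
      where
      at : Cpair E′ bags χ m v w ≡ bit u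
      at rewrite updateRel-at u E v w | Equivalence.to T-≡ vw∈m = ∧-identityʳ (bit u)
      sep : ∀ y z → T (Cpair E′ bags χ m y z) → χ y ≡ χ v → χ z ≡ χ w → y ≡ v × z ≡ w
      sep y z yz∈ χy≡χv χz≡χw with introduces⇒ (proj₂ (Equivalence.to (T-∧ {E′ y z}) yz∈)) | introduces⇒ vw∈m
      ... | y∈m , z∈m , _ | v∈m , w∈m , _ = proper m y v y∈m v∈m χy≡χv , proper m z w z∈m w∈m χz≡χw

    label-elsewhere : IsTreeDecomposition nV E⋆ t bags →
                      ∀ m → m ≢ introNode v w → succinctLabel E′ bags χ m ≡ succinctLabel E bags χ m
    label-elsewhere td m m≢node = label-unchanged m (m≢node ∘ introduces⇒introNode td)

    label-at : succinctLabel E′ bags χ (introNode v w) ≡ relabel u v w (succinctLabel E bags χ (introNode v w))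
    label-at with anyPos? (introduces v w)
    ... | yes (p , vw∈p) = label-introducing p vw∈p
    ... | no  none       = label-unchanged here (λ vw∈root → none (here , vw∈root))

module BulletEdges {K q : ℕ} (𝒜 : Automaton K q) (t : BTree) where
  open Gamma 𝒜 t

  -- Post-order numbers start at 1, so node p is handled by the Γ-vertices (slot p) and (slot p, γ).
  slot : Pos t → ℕ
  slot p = pred (post p)

  post≡suc-slot : ∀ p → post p ≡ suc (slot p)
  post≡suc-slot p with post p | 1≤post p
  ... | suc _ | _ = refl

  slot<N : ∀ p → slot p < N
  slot<N p = subst (_≤ N) (post≡suc-slot p) (post≤size p)

  bulletEdge : (Pos t → Sig K) → Pos t → Triple 𝒜 t
  bulletEdge λG p = pre (slot p) (slot<N p) , bullet , lab (slot p) (slot<N p) (λG p)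

  bulletEdge-edge : ∀ λG p → EdgeT 𝒜 t λG (bulletEdge λG p)
  bulletEdge-edge λG p = e• (slot p) (slot<N p) p (post≡suc-slot p)

  at-slot : ∀ {n j} p → post n ≡ suc j → j ≡ slot p → n ≡ p
  at-slot p n↦j refl = post-injective (trans n↦j (sym (post≡suc-slot p)))

  off-slot : ∀ {n j} p → post n ≡ suc j → j ≢ slot p → n ≢ p
  off-slot p n↦j j≢ refl = j≢ (suc-injective (trans (sym n↦j) (post≡suc-slot p)))

  relabel-one-node : ∀ (λG λG′ : Pos t → Sig K) p → (∀ m → m ≢ p → λG′ m ≡ λG m) →
                     DeleteInsert 𝒜 t λG λG′ (bulletEdge λG p) (bulletEdge λG′ p)
  relabel-one-node λG λG′ p unchanged = bulletEdge-edge λG p , λ x l y → mk⇔ to from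
    where
    Removed Added : Vtx → Lbl → Vtx → Set
    Removed x l y = Edge λG x l y × ¬ ((x , l , y) ≡ bulletEdge λG p)
    Added x l y = (x , l , y) ≡ bulletEdge λG′ p
    preIndex : Vtx → ℕ
    preIndex (pre j _) = j
    preIndex _         = 0
    to : ∀ {x l y} → Edge λG′ x l y → Removed x l y ⊎ Added x l y
    to (e⁺ j j<N π)   = inj₁ (e⁺ j j<N π , λ ())
    to (e⁻ j j<N π γ) = inj₁ (e⁻ j j<N π γ , λ ())
    to (e⊤ π acc)     = inj₁ (e⊤ π acc , λ ())
    to (e• j j<N n n↦j) with j ≟ slot p
    ... | yes j≡ with at-slot {n = n} p n↦j j≡ | j≡
    ...   | refl | refl = inj₂ refl
    to (e• j j<N n n↦j) | no j≢ =
      inj₁ (subst (λ γ → Edge λG (pre j j<N) bullet (lab j j<N γ)) (sym (unchanged n (off-slot p n↦j j≢))) (e• j j<N n n↦j) ,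
            j≢ ∘ cong (preIndex ∘ proj₁))
    from : ∀ {x l y} → Removed x l y ⊎ Added x l y → Edge λG′ x l y
    from (inj₁ (e⁺ j j<N π , _))   = e⁺ j j<N π
    from (inj₁ (e⁻ j j<N π γ , _)) = e⁻ j j<N π γ
    from (inj₁ (e⊤ π acc , _))     = e⊤ π acc
    from (inj₁ (e• j j<N n n↦j , ≢e₁)) with j ≟ slot p
    ... | yes j≡ with at-slot {n = n} p n↦j j≡ | j≡
    ...   | refl | refl = ⊥-elim (≢e₁ refl)
    from (inj₁ (e• j j<N n n↦j , _)) | no j≢ =
      subst (λ γ → Edge λG′ (pre j j<N) bullet (lab j j<N γ)) (unchanged n (off-slot p n↦j j≢)) (e• j j<N n n↦j)
    from (inj₂ refl) = bulletEdge-edge λG′ p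

  module Definability {nV : ℕ} (node : Fin nV → Fin nV → Pos t) (relabel : Fin nV → Fin nV → Sig K → Sig K) where
    private
      D : Set
      D = Dom 𝒜 t nV
      vtx : Vtx → D
      vtx = inj₂ ∘ inj₁
      lbl : Lbl → D
      lbl = inj₂ ∘ inj₂

    IsSlotOf : D → D → D → Set
    IsSlotOf (inj₁ v) (inj₁ w) a = a ≡ vtx (pre (slot (node v w)) (slot<N (node v w)))
    IsSlotOf _        _        _ = ⊥

    Relabels : D → D → D → D → Set
    Relabels (inj₁ v) (inj₁ w) c c′ =
      ∃ λ j → ∃ λ (j<N : j < N) → ∃ λ γ → c ≡ vtx (lab j j<N γ) × c′ ≡ vtx (lab j j<N (relabel v w γ))
    Relabels _        _        _ _  = ⊥

    pattern slotᴿ    = zero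
    pattern relabelᴿ = suc zero

    arity : Fin 2 → ℕ
    arity slotᴿ    = 3
    arity relabelᴿ = 4

    holds : (r : Fin 2) → (Fin (arity r) → D) → Set
    holds slotᴿ    xs = IsSlotOf (xs (# 0)) (xs (# 1)) (xs (# 2))
    holds relabelᴿ xs = Relabels (xs (# 0)) (xs (# 1)) (xs (# 2)) (xs (# 3))

    aux : AuxRels D
    aux = record { k = 2 ; ar = arity ; rel = holds }

    -- Variables 0–4 stand for v, w and the source, label and target of the edge; under the
    -- quantifier of ψ₂ they are shifted to 1–5.
    ψ₁ : FO aux 5
    ψ₁ = andᶠ (relᶠ slotᴿ (lookup (# 0 ∷ # 1 ∷ # 2 ∷ []))) (edgeᶠ (# 2) (# 3) (# 4))

    ψ₂ : FO aux 5
    ψ₂ = exᶠ (andᶠ (relᶠ slotᴿ (lookup (# 1 ∷ # 2 ∷ # 3 ∷ [])))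
             (andᶠ (edgeᶠ (# 3) (# 4) (# 0)) (relᶠ relabelᴿ (lookup (# 1 ∷ # 2 ∷ # 0 ∷ # 5 ∷ [])))))

    out-of-slot : ∀ λG p {b c : D} → ΓRel 𝒜 t λG (vtx (pre (slot p) (slot<N p))) b c →
                  b ≡ lbl bullet × c ≡ vtx (lab (slot p) (slot<N p) (λG p))
    out-of-slot λG p {inj₂ (inj₂ _)} {inj₂ (inj₁ _)} (e• j j<N n n↦j) with at-slot {n = n} p n↦j refl
    ... | refl = refl , refl

    defines-ψ₁ : ∀ λG v w → DefinesEdge 𝒜 t ψ₁ λG v w (bulletEdge λG (node v w))
    defines-ψ₁ λG v w a b c = mk⇔ (λ { (refl , e) → refl , out-of-slot λG (node v w) e })
                                  (λ { (refl , refl , refl) → refl , bulletEdge-edge λG (node v w) })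

    defines-ψ₂ : ∀ λG λG′ v w → λG′ (node v w) ≡ relabel v w (λG (node v w)) →
                 DefinesEdge 𝒜 t ψ₂ λG v w (bulletEdge λG′ (node v w))
    defines-ψ₂ λG λG′ v w relabelled a b c = mk⇔ to from
      where
      p : Pos t
      p = node v w
      relabelled-vtx : vtx (lab (slot p) (slot<N p) (relabel v w (λG p))) ≡ vtx (lab (slot p) (slot<N p) (λG′ p))
      relabelled-vtx = cong (vtx ∘ lab (slot p) (slot<N p)) (sym relabelled)
      to : SatFO (ΓRel 𝒜 t λG) ψ₂ (env5 (inj₁ v) (inj₁ w) a b c) →
           a ≡ vtx (pre (slot p) (slot<N p)) × b ≡ lbl bullet × c ≡ vtx (lab (slot p) (slot<N p) (λG′ p))
      to (x , refl , e , j , j<N , γ , refl , refl) with out-of-slot λG p e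
      ... | refl , refl = refl , refl , relabelled-vtx
      from : a ≡ vtx (pre (slot p) (slot<N p)) × b ≡ lbl bullet × c ≡ vtx (lab (slot p) (slot<N p) (λG′ p)) →
             SatFO (ΓRel 𝒜 t λG) ψ₂ (env5 (inj₁ v) (inj₁ w) a b c)
      from (refl , refl , refl) =
        vtx (lab (slot p) (slot<N p) (λG p)) , refl , bulletEdge-edge λG p , slot p , slot<N p , λG p , refl , sym relabelled-vtx

proposition2 : (κ : ℕ) (φ : MSO 0 0) (q : ℕ) (𝒜 : Automaton (Kof κ) q) → AutomatonFor φ 𝒜 →
    (nV : ℕ) (E⋆ : Rel nV) (t : BTree) (bags : Pos t → Subset nV) (χ : Fin nV → Fin (suc (Kof κ))) →
    IsTreeDecomposition nV E⋆ t bags → WidthAtMost (Kof κ) bags → ProperColoring bags χ →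
    (u : Update) →
    Σ (AuxRels (Dom 𝒜 t nV)) λ aux → Σ (FO aux 5) λ ψ₁ → Σ (FO aux 5) λ ψ₂ →
      ∀ (E : Rel nV) (v w : Fin nV) → SubRel E E⋆ → T (E⋆ v w) →
      Σ (Triple 𝒜 t) λ e₁ → Σ (Triple 𝒜 t) λ e₂ →
        DeleteInsert 𝒜 t (succinctLabel E bags χ) (succinctLabel (updateRel u E v w) bags χ) e₁ e₂
        × DefinesEdge 𝒜 t ψ₁ (succinctLabel E bags χ) v w e₁
        × DefinesEdge 𝒜 t ψ₂ (succinctLabel E bags χ) v w e₂
proposition2 κ φ q 𝒜 _ nV E⋆ t bags χ td _ proper u = aux , ψ₁ , ψ₂ , λ E v w _ _ →
  let λG  = succinctLabel E bags χ
      λG′ = succinctLabel (updateRel u E v w) bags χ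
  in  bulletEdge λG (introNode v w) , bulletEdge λG′ (introNode v w) ,
      relabel-one-node λG λG′ (introNode v w) (label-elsewhere proper u E v w td) ,
      defines-ψ₁ λG v w ,
      defines-ψ₂ λG λG′ v w (label-at proper u E v w)
  where
  open EdgeUpdate E⋆ bags χ
  open BulletEdges 𝒜 t
  open Definability introNode (relabel u)
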